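{- Let $\mathcal D=(A,U)$ be a decision problem on a product state space $S=X_1\times\cdots\times X_n$ in which each coordinate type $X_i$ has decidable equality, and let $I\subseteq\{1,\dots,n\}$ be a minimal sufficient set for $\mathcal D$. Then for every coordinate $i$, $i\in I$ if and only if $i$ is relevant for $\mathcal D$. Consequently, whenever a minimal sufficient set exists, it is unique.
   Context: A decision problem on $S=X_1\times\cdots\times X_n$ consists of an action set $A$ and a utility $U:A\times S\to\mathbb R$, with optimizer map $\mathrm{Opt}(s)=\{a\in A:\ U(a',s)\le U(a,s)\ \forall a'\in A\}$. For $I\subseteq\{1,\dots,n\}$, $I$ is sufficient if whenever $s_j=s'_j$ for all $j\in I$ we have $\mathrm{Opt}(s)=\mathrm{Opt}(s')$; $I$ is minimal sufficient if it is sufficient and no proper subset of $I$ is sufficient. A coordinate $i$ is relevant if there exist $s,s'\in S$ agreeing on all coordinates $j\neq i$ with $\mathrm{Opt}(s)\neq\mathrm{Opt}(s')$. -}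

module Defs where

open import Level using (0ℓ)
open import Data.Nat using (ℕ)
open import Data.Fin using (Fin)
open import Data.Fin.Subset using (Subset; _∈_; _⊂_)
open import Data.Product using (_×_; ∃; ∃-syntax)
open import Function.Bundles using (_⇔_)
open import Relation.Binary.Bundles using (TotalOrder)
open import Relation.Binary.PropositionalEquality using (_≡_; _≢_)
open import Relation.Nullary using (¬_)

State : {n : ℕ} → (Fin n → Set) → Set
State {n} X = (i : Fin n) → X i

-- A decision problem: an action set A and a utility U : A × S → R,
-- where R is a totally ordered codomain (stands in for ℝ).
record DecisionProblem {n : ℕ} (X : Fin n → Set) (R : TotalOrder 0ℓ 0ℓ 0ℓ) : Set₁ where
  open TotalOrder R using (Carrier; _≤_)
  field
    Action  : Set
    utility : Action → State X → Carrier

  Opt : State X → Action → Set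
  Opt s a = ∀ (a' : Action) → utility a' s ≤ utility a s

  SameOpt : State X → State X → Set
  SameOpt s s' = ∀ (a : Action) → (Opt s a ⇔ Opt s' a)

  AgreeOn : Subset n → State X → State X → Set
  AgreeOn I s s' = ∀ (j : Fin n) → j ∈ I → s j ≡ s' j

  Sufficient : Subset n → Set
  Sufficient I = ∀ (s s' : State X) → AgreeOn I s s' → SameOpt s s'

  MinimalSufficient : Subset n → Set
  MinimalSufficient I = Sufficient I × (∀ (J : Subset n) → J ⊂ I → ¬ Sufficient J)

  Relevant : Fin n → Set
  Relevant i = ∃[ s ] ∃[ s' ] ((∀ (j : Fin n) → j ≢ i → s j ≡ s' j) × ¬ SameOpt s s')

-- A sufficient set contains every relevant coordinate: if it missed one, two states
-- differing only there would agree on it. Conversely an irrelevant coordinate i can be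
-- dropped from a sufficient set I: states s, s' agreeing on I - i are linked through
-- s with its i-th coordinate overwritten by that of s', which differs from s only at i
-- and agrees with s' on I. So a minimal sufficient set consists exactly of the relevant
-- coordinates; classical logic enters because irrelevance is a negated existential.
module Submission where

open import Defs
open import Level using (0ℓ)
open import Data.Nat using (ℕ)
open import Data.Fin using (Fin; _≟_)
open import Data.Fin.Subset using (Subset; _∈_; _-_)
open import Data.Fin.Subset.Properties using (_∈?_; ⊆-antisym; x∈p⇒p-x⊂p; x∈p∧x≢y⇒x∈p-y)
open import Data.Product using (_×_; _,_)
open import Function.Base using (_∘_)
open import Function.Bundles using (_⇔_; mk⇔; Equivalence)
import Function.Properties.Equivalence as ⇔
open import Relation.Binary.Bundles using (TotalOrder)
open import Relation.Binary.Definitions using (DecidableEquality)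
open import Relation.Binary.PropositionalEquality using (_≡_; _≢_; refl; sym)
open import Relation.Nullary using (¬_; yes; no; contradiction)
open import Relation.Nullary.Decidable using (decidable-stable)
open import Axiom.ExcludedMiddle using (ExcludedMiddle)
open import Axiom.DoubleNegationElimination using (DoubleNegationElimination; em⇒dne)

module _ {n : ℕ} {X : Fin n → Set} where

  _[_]≔_ : State X → (i : Fin n) → X i → State X
  (s [ i ]≔ x) j with j ≟ i
  ... | yes refl = x
  ... | no _     = s j

  []≔-minimal : ∀ (s : State X) {i j} (x : X i) → j ≢ i → (s [ i ]≔ x) j ≡ s j
  []≔-minimal s {i} {j} x j≢i with j ≟ i
  ... | yes j≡i = contradiction j≡i j≢i
  ... | no _    = refl

module _ {n : ℕ} {X : Fin n → Set} {R : TotalOrder 0ℓ 0ℓ 0ℓ} (D : DecisionProblem X R) where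
  open DecisionProblem D

  AgreeOff : Fin n → State X → State X → Set
  AgreeOff i s s' = ∀ j → j ≢ i → s j ≡ s' j

  Irrelevant : Fin n → Set
  Irrelevant i = ∀ s s' → AgreeOff i s s' → SameOpt s s'

  SameOpt-trans : ∀ {s t u} → SameOpt s t → SameOpt t u → SameOpt s u
  SameOpt-trans s~t t~u a = ⇔.trans (s~t a) (t~u a)

  ¬relevant⇒irrelevant : DoubleNegationElimination 0ℓ → ∀ {i} → ¬ Relevant i → Irrelevant i
  ¬relevant⇒irrelevant dne ¬rel s s' agree = dne λ ¬same → ¬rel (s , s' , agree , ¬same)

  relevant⇒∈-sufficient : ∀ {I i} → Sufficient I → Relevant i → i ∈ I
  relevant⇒∈-sufficient {I} {i} suf (s , s' , agree , ¬same) =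
    decidable-stable (i ∈? I) λ i∉I → ¬same (suf s s' λ j j∈I → agree j λ { refl → i∉I j∈I })

  agreeOn-[]≔ : ∀ {I i s s'} → AgreeOn (I - i) s s' → AgreeOn I (s [ i ]≔ s' i) s'
  agreeOn-[]≔ {i = i} agree j j∈I with j ≟ i
  ... | yes refl = refl
  ... | no j≢i   = agree j (x∈p∧x≢y⇒x∈p-y j∈I j≢i)

  sufficient-minus-irrelevant : ∀ {I i} → Irrelevant i → Sufficient I → Sufficient (I - i)
  sufficient-minus-irrelevant {i = i} irr suf s s' agree =
    SameOpt-trans (irr s t λ j j≢i → sym ([]≔-minimal s (s' i) j≢i)) (suf t s' (agreeOn-[]≔ agree))
    where
    t : State X
    t = s [ i ]≔ s' i

  minimal⇒relevant : DoubleNegationElimination 0ℓ →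
                     ∀ {I i} → MinimalSufficient I → i ∈ I → Relevant i
  minimal⇒relevant dne {I} {i} (suf , minimal) i∈I = dne λ ¬rel →
    minimal (I - i) (x∈p⇒p-x⊂p i∈I)
      (sufficient-minus-irrelevant (¬relevant⇒irrelevant dne ¬rel) suf)

  minimal⇒∈⇔relevant : DoubleNegationElimination 0ℓ →
                       ∀ {I} → MinimalSufficient I → ∀ i → i ∈ I ⇔ Relevant i
  minimal⇒∈⇔relevant dne min@(suf , _) i =
    mk⇔ (minimal⇒relevant dne min) (relevant⇒∈-sufficient suf)

  minimalSufficient-unique : DoubleNegationElimination 0ℓ →
                             ∀ {I J} → MinimalSufficient I → MinimalSufficient J → I ≡ J
  minimalSufficient-unique dne {I} {J} minI minJ = ⊆-antisym
    (λ {i} → Equivalence.from (J⇔ i) ∘ Equivalence.to (I⇔ i))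
    (λ {i} → Equivalence.from (I⇔ i) ∘ Equivalence.to (J⇔ i))
    where
    I⇔ : ∀ i → i ∈ I ⇔ Relevant i
    I⇔ = minimal⇒∈⇔relevant dne minI
    J⇔ : ∀ i → i ∈ J ⇔ Relevant i
    J⇔ = minimal⇒∈⇔relevant dne minJ

-- Decidable equality of the coordinate types is not needed: updating a state only
-- compares indices in Fin n.
mainTheorem2 : ExcludedMiddle 0ℓ →
    {n : ℕ} (X : Fin n → Set) (R : TotalOrder 0ℓ 0ℓ 0ℓ) (D : DecisionProblem X R) →
    (∀ (i : Fin n) → DecidableEquality (X i)) →
    ((I : Subset n) → DecisionProblem.MinimalSufficient D I →
      ∀ (i : Fin n) → (i ∈ I ⇔ DecisionProblem.Relevant D i))
    × ((I J : Subset n) → DecisionProblem.MinimalSufficient D I →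
      DecisionProblem.MinimalSufficient D J → I ≡ J)
mainTheorem2 em X R D _ =
    (λ _ → minimal⇒∈⇔relevant D dne)
  , (λ _ _ → minimalSufficient-unique D dne)
  where
  dne : DoubleNegationElimination 0ℓ
  dne = em⇒dne em
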